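{- Let $G$ be a finite simple connected graph and let $V_1,\dots,V_\ell$ be subsets of $V(G)$ with $\bigcup_{i=1}^{\ell}V_i=V(G)$. Then for every $k\ge 0$, $\mathrm{f}\mu^{k}(G)\le \sum_{i=1}^{\ell}\mathrm{f}\mu^{k}(\mathrm{hull}(V_i))$.
   Context: For an integer $k\ge 0$ and a connected graph $G$, a set $X\subseteq V(G)$ is a $k$-fault-tolerant mutual-visibility set ($k$-ftmv set) if for any two non-adjacent vertices $u,v\in X$ there exist $k+1$ internally vertex-disjoint shortest $u,v$-paths $Q_1,\dots,Q_{k+1}$ in $G$ such that $V(Q_i)\cap X=\{u,v\}$ for every $i$. $\mathrm{f}\mu^{k}(G)$ denotes the maximum cardinality of a $k$-ftmv set of $G$. A subgraph $H$ of $G$ is convex if for any two vertices of $H$, every shortest path in $G$ between them lies completely in $H$. For $V'\subseteq V(G)$, $\mathrm{hull}(V')$ is the smallest convex subgraph of $G$ containing $V'$. -}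

module Defs where

open import Data.Nat using (ℕ; zero; suc; _≤_)
open import Data.Bool using (Bool; true; false)
open import Data.Fin using (Fin)
open import Data.Fin.Subset using (Subset; _∈_; _⊆_; ⊤; ∣_∣)
open import Data.List using (List; []; _∷_; map; allFin)
open import Data.Nat.ListAction using (sum)
open import Data.List.Membership.Propositional using () renaming (_∈_ to _∈ₗ_)
open import Data.Product using (Σ; ∃; _×_; _,_)
open import Data.Sum using (_⊎_)
open import Relation.Binary.PropositionalEquality using (_≡_; _≢_)
open import Relation.Nullary using (¬_)

record Graph : Set where
  field
    n     : ℕ
    adj   : Fin n → Fin n → Bool
    sym   : ∀ u v → adj u v ≡ adj v u
    irrefl : ∀ u → adj u u ≡ false

module _ (G : Graph) where
  open Graph G

  Adj : Fin n → Fin n → Set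
  Adj u v = adj u v ≡ true

  -- Walks from u to v in the subgraph of G induced by the vertex set S.
  data Walk (S : Subset n) : Fin n → Fin n → Set where
    [_] : ∀ {u} → u ∈ S → Walk S u u
    step : ∀ {u w v} → u ∈ S → Adj u w → Walk S w v → Walk S u v

  len : ∀ {S u v} → Walk S u v → ℕ
  len [ _ ] = 0
  len (step _ _ p) = suc (len p)

  verts : ∀ {S u v} → Walk S u v → List (Fin n)
  verts {u = u} [ _ ] = u ∷ []
  verts {u = u} (step _ _ p) = u ∷ verts p

  IsShortest : ∀ {S u v} → Walk S u v → Set
  IsShortest {S} {u} {v} p = (q : Walk S u v) → len p ≤ len q

  Connected : Set
  Connected = ∀ u v → Walk ⊤ u v

  Convex : Subset n → Set
  Convex S = ∀ {u v} → u ∈ S → v ∈ S → (p : Walk ⊤ u v) → IsShortest p →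
             ∀ {x} → x ∈ₗ verts p → x ∈ S

  IsHull : Subset n → Subset n → Set
  IsHull V' H = Convex H × V' ⊆ H × (∀ C → Convex C → V' ⊆ C → H ⊆ C)

  IsFTMV : ℕ → Subset n → Subset n → Set
  IsFTMV k S X = X ⊆ S ×
    (∀ {u v} → u ∈ X → v ∈ X → u ≢ v → ¬ Adj u v →
      Σ (Fin (suc k) → Walk S u v) λ Q →
        (∀ i → IsShortest (Q i)) ×
        (∀ i {x} → x ∈ₗ verts (Q i) → x ∈ X → x ≡ u ⊎ x ≡ v) ×
        (∀ i j → i ≢ j → ∀ {x} → x ∈ₗ verts (Q i) → x ∈ₗ verts (Q j) →
           x ≡ u ⊎ x ≡ v))

  IsFmu : ℕ → Subset n → ℕ → Set
  IsFmu k S m = (Σ (Subset n) λ X → IsFTMV k S X × ∣ X ∣ ≡ m) ×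
                (∀ X → IsFTMV k S X → ∣ X ∣ ≤ m)

sumFin : ∀ {ℓ} → (Fin ℓ → ℕ) → ℕ
sumFin {ℓ} f = sum (map f (allFin ℓ))

{-# OPTIONS --safe #-}
module Submission where

-- Let X be a maximum k-ftmv set of G. Since the hulls H_i cover V(G), the union bound gives
-- |X| ≤ Σ |X ∩ H_i|. Each X ∩ H_i is a k-ftmv set of G[H_i]: by convexity every shortest path
-- of G between two vertices of H_i stays inside H_i, and being a subset of X it inherits the
-- paths witnessing fault-tolerant visibility.

open import Defs
open import Data.Nat using (ℕ; _≤_; _+_; suc; z≤n; s≤s)
open import Data.Nat.Properties using (≤-trans; ≤-reflexive; +-suc; +-mono-≤; +-monoʳ-≤; n≤1+n; module ≤-Reasoning)
open import Data.Nat.ListAction using (sum)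
open import Data.Fin using (Fin)
open import Data.Fin.Subset using (Subset; _∈_; _⊆_; _∪_; _∩_; ⋃; ⊤; ∣_∣; inside; outside)
open import Data.Fin.Subset.Properties using (p⊆q⇒∣p∣≤∣q∣; ∣⊥∣≡0; x∈p∩q⁺; p∩q⊆p; p∩q⊆q; p⊆p∪q; q⊆p∪q; ⊆⊤)
open import Data.List using (List; []; _∷_; map; allFin)
open import Data.List.Properties using (map-∘)
open import Data.List.Membership.Propositional using () renaming (_∈_ to _∈ₗ_)
open import Data.List.Membership.Propositional.Properties using (∈-allFin; ∈-map⁺)
open import Data.List.Relation.Unary.Any using (here; there)
open import Data.Product using (Σ; ∃; _×_; _,_; proj₁; proj₂)
open import Data.Sum using (_⊎_)
open import Data.Vec using (_∷_; [])
open import Function using (_∘_)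
open import Relation.Binary.PropositionalEquality using (_≡_; _≢_; refl; cong; sym; subst)

∣p∪q∣≤∣p∣+∣q∣ : ∀ {n} (p q : Subset n) → ∣ p ∪ q ∣ ≤ ∣ p ∣ + ∣ q ∣
∣p∪q∣≤∣p∣+∣q∣ []            []            = z≤n
∣p∪q∣≤∣p∣+∣q∣ (outside ∷ p) (outside ∷ q) = ∣p∪q∣≤∣p∣+∣q∣ p q
∣p∪q∣≤∣p∣+∣q∣ (outside ∷ p) (inside  ∷ q) =
  ≤-trans (s≤s (∣p∪q∣≤∣p∣+∣q∣ p q)) (≤-reflexive (sym (+-suc ∣ p ∣ ∣ q ∣)))
∣p∪q∣≤∣p∣+∣q∣ (inside  ∷ p) (outside ∷ q) = s≤s (∣p∪q∣≤∣p∣+∣q∣ p q)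
∣p∪q∣≤∣p∣+∣q∣ (inside  ∷ p) (inside  ∷ q) =
  s≤s (≤-trans (∣p∪q∣≤∣p∣+∣q∣ p q) (+-monoʳ-≤ ∣ p ∣ (n≤1+n ∣ q ∣)))

∣⋃ps∣≤sum∣ps∣ : ∀ {n} (ps : List (Subset n)) → ∣ ⋃ ps ∣ ≤ sum (map ∣_∣ ps)
∣⋃ps∣≤sum∣ps∣ {n} [] = ≤-reflexive (∣⊥∣≡0 n)
∣⋃ps∣≤sum∣ps∣ (p ∷ ps) =
  ≤-trans (∣p∪q∣≤∣p∣+∣q∣ p (⋃ ps)) (+-monoʳ-≤ ∣ p ∣ (∣⋃ps∣≤sum∣ps∣ ps))

x∈⋃⁺ : ∀ {n} {x : Fin n} {p ps} → x ∈ p → p ∈ₗ ps → x ∈ ⋃ ps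
x∈⋃⁺ {ps = p ∷ ps} x∈p (here refl) = p⊆p∪q (⋃ ps) x∈p
x∈⋃⁺ {ps = p ∷ ps} x∈p (there p∈ps) = q⊆p∪q p (⋃ ps) (x∈⋃⁺ x∈p p∈ps)

sum-map-mono : ∀ {a} {A : Set a} {f g : A → ℕ} → (∀ x → f x ≤ g x) →
               ∀ xs → sum (map f xs) ≤ sum (map g xs)
sum-map-mono f≤g []       = z≤n
sum-map-mono f≤g (x ∷ xs) = +-mono-≤ (f≤g x) (sum-map-mono f≤g xs)

∣p∣≤sumFin∣p∩q∣ : ∀ {n ℓ} (p : Subset n) (q : Fin ℓ → Subset n) → (∀ x → ∃ λ i → x ∈ q i) →
                 ∣ p ∣ ≤ sumFin (λ i → ∣ p ∩ q i ∣)
∣p∣≤sumFin∣p∩q∣ {n} {ℓ} p q covers = begin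
  ∣ p ∣                                ≤⟨ p⊆q⇒∣p∣≤∣q∣ p⊆⋃p∩q ⟩
  ∣ ⋃ p∩qs ∣                           ≤⟨ ∣⋃ps∣≤sum∣ps∣ p∩qs ⟩
  sum (map ∣_∣ p∩qs)                   ≡⟨ cong sum (map-∘ (allFin ℓ)) ⟨
  sumFin (λ i → ∣ p ∩ q i ∣)           ∎
  where
  open ≤-Reasoning
  p∩qs : List (Subset n)
  p∩qs = map (λ i → p ∩ q i) (allFin ℓ)
  p⊆⋃p∩q : ∀ {x} → x ∈ p → x ∈ ⋃ p∩qs
  p⊆⋃p∩q {x} x∈p with covers x
  ... | i , x∈qi = x∈⋃⁺ (x∈p∩q⁺ (x∈p , x∈qi)) (∈-map⁺ (λ j → p ∩ q j) (∈-allFin i))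

module _ (G : Graph) where
  open Graph G using (n)

  private variable
    S T X Y : Subset n
    u v : Fin n

  weaken : S ⊆ T → Walk G S u v → Walk G T u v
  weaken S⊆T [ u∈S ]            = [ S⊆T u∈S ]
  weaken S⊆T (step u∈S u~w p)   = step (S⊆T u∈S) u~w (weaken S⊆T p)

  weaken-len : (S⊆T : S ⊆ T) (p : Walk G S u v) → len G (weaken S⊆T p) ≡ len G p
  weaken-len S⊆T [ _ ]          = refl
  weaken-len S⊆T (step _ _ p)   = cong suc (weaken-len S⊆T p)

  restrict : (p : Walk G T u v) → (∀ {x} → x ∈ₗ verts G p → x ∈ S) → Walk G S u v
  restrict [ _ ]          p⊆S = [ p⊆S (here refl) ]
  restrict (step _ u~w p) p⊆S = step (p⊆S (here refl)) u~w (restrict p (p⊆S ∘ there))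

  restrict-len : (p : Walk G T u v) (p⊆S : ∀ {x} → x ∈ₗ verts G p → x ∈ S) →
                 len G (restrict p p⊆S) ≡ len G p
  restrict-len [ _ ]        p⊆S = refl
  restrict-len (step _ _ p) p⊆S = cong suc (restrict-len p (p⊆S ∘ there))

  restrict-verts : (p : Walk G T u v) (p⊆S : ∀ {x} → x ∈ₗ verts G p → x ∈ S) →
                   verts G (restrict p p⊆S) ≡ verts G p
  restrict-verts [ _ ]        p⊆S = refl
  restrict-verts (step _ _ p) p⊆S = cong (_ ∷_) (restrict-verts p (p⊆S ∘ there))

  restrict-isShortest : S ⊆ T → (p : Walk G T u v) (p⊆S : ∀ {x} → x ∈ₗ verts G p → x ∈ S) →
                        IsShortest G p → IsShortest G (restrict p p⊆S)
  restrict-isShortest S⊆T p p⊆S p-shortest q = begin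
    len G (restrict p p⊆S)  ≡⟨ restrict-len p p⊆S ⟩
    len G p                 ≤⟨ p-shortest (weaken S⊆T q) ⟩
    len G (weaken S⊆T q)    ≡⟨ weaken-len S⊆T q ⟩
    len G q                 ∎
    where open ≤-Reasoning

  FaultTolerantPaths : ℕ → Subset n → Subset n → Fin n → Fin n → Set
  FaultTolerantPaths k S X u v =
    Σ (Fin (suc k) → Walk G S u v) λ Q →
      (∀ i → IsShortest G (Q i)) ×
      (∀ i {x} → x ∈ₗ verts G (Q i) → x ∈ X → x ≡ u ⊎ x ≡ v) ×
      (∀ i j → i ≢ j → ∀ {x} → x ∈ₗ verts G (Q i) → x ∈ₗ verts G (Q j) → x ≡ u ⊎ x ≡ v)

  IsFTMV-⊆ : ∀ {k} → IsFTMV G k S X → Y ⊆ X → IsFTMV G k S Y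
  IsFTMV-⊆ (X⊆S , paths) Y⊆X = X⊆S ∘ Y⊆X , λ u∈Y v∈Y u≢v u≁v →
    let Q , shortest , avoid , disjoint = paths (Y⊆X u∈Y) (Y⊆X v∈Y) u≢v u≁v
    in Q , shortest , (λ i x∈Qi x∈Y → avoid i x∈Qi (Y⊆X x∈Y)) , disjoint

  FaultTolerantPaths-convex : ∀ {k} → Convex G S → u ∈ S → v ∈ S →
                              FaultTolerantPaths k ⊤ X u v → FaultTolerantPaths k S X u v
  FaultTolerantPaths-convex {S} {u} {v} {X} {k} S-convex u∈S v∈S (Q , shortest , avoid , disjoint) =
    Q′ , shortest′ , (λ i x∈Q′i → avoid i (∈Q′⇒∈Q i x∈Q′i)) ,
    (λ i j i≢j x∈Q′i x∈Q′j → disjoint i j i≢j (∈Q′⇒∈Q i x∈Q′i) (∈Q′⇒∈Q j x∈Q′j))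
    where
    Q⊆S : ∀ i {x} → x ∈ₗ verts G (Q i) → x ∈ S
    Q⊆S i = S-convex u∈S v∈S (Q i) (shortest i)
    Q′ : Fin (suc k) → Walk G S u v
    Q′ i = restrict (Q i) (Q⊆S i)
    ∈Q′⇒∈Q : ∀ i {x} → x ∈ₗ verts G (Q′ i) → x ∈ₗ verts G (Q i)
    ∈Q′⇒∈Q i = subst (_ ∈ₗ_) (restrict-verts (Q i) (Q⊆S i))
    shortest′ : ∀ i → IsShortest G (Q′ i)
    shortest′ i = restrict-isShortest ⊆⊤ (Q i) (Q⊆S i) (shortest i)

  IsFTMV-convex : ∀ {k} → Convex G S → X ⊆ S → IsFTMV G k ⊤ X → IsFTMV G k S X
  IsFTMV-convex S-convex X⊆S (_ , paths) = X⊆S , λ u∈X v∈X u≢v u≁v →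
    FaultTolerantPaths-convex S-convex (X⊆S u∈X) (X⊆S v∈X) (paths u∈X v∈X u≢v u≁v)

lemma3p5 : (G : Graph) → Connected G →
    (ℓ : ℕ) (V : Fin ℓ → Subset (Graph.n G)) →
    (∀ x → ∃ λ i → x ∈ V i) →
    (H : Fin ℓ → Subset (Graph.n G)) → (∀ i → IsHull G (V i) (H i)) →
    (k : ℕ) (m : ℕ) (ms : Fin ℓ → ℕ) →
    IsFmu G k ⊤ m → (∀ i → IsFmu G k (H i) (ms i)) →
    m ≤ sumFin ms
lemma3p5 G _ ℓ V V-covers H hull k m ms ((X , X-ftmv , ∣X∣≡m) , _) ms-fmu = begin
  m                            ≡⟨ ∣X∣≡m ⟨
  ∣ X ∣                        ≤⟨ ∣p∣≤sumFin∣p∩q∣ X H H-covers ⟩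
  sumFin (λ i → ∣ X ∩ H i ∣)   ≤⟨ sum-map-mono ∣X∩H∣≤ms (allFin ℓ) ⟩
  sumFin ms                    ∎
  where
  open ≤-Reasoning
  H-covers : ∀ x → ∃ λ i → x ∈ H i
  H-covers x = let i , x∈Vi = V-covers x in i , proj₁ (proj₂ (hull i)) x∈Vi
  ∣X∩H∣≤ms : ∀ i → ∣ X ∩ H i ∣ ≤ ms i
  ∣X∩H∣≤ms i = proj₂ (ms-fmu i) (X ∩ H i)
    (IsFTMV-convex G (proj₁ (hull i)) (p∩q⊆q X (H i)) (IsFTMV-⊆ G X-ftmv (p∩q⊆p X (H i))))
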